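{- Let $n\ge1$ and let $\lambda$ be a partition with $n$ parts. The function $x^{ -\delta}Z_\lambda(x|a)$ is symmetric in $x_1,\ldots,x_n$.
   Context: $\delta=(0,1,\ldots,n-1)$ and $x^{ -\delta}=x_1^{0}x_2^{ -1}\cdots x_n^{ -(n-1)}$. Let $\lambda=(\lambda_1\ge\cdots\ge\lambda_n\ge0)$. Consider the grid of vertices $(r,c)$, $1\le r\le n$ (rows, top to bottom), $1\le c\le n+\lambda_1$ (columns, left to right), with horizontal edges between $(r,c),(r,c+1)$, vertical edges between $(r,c),(r+1,c)$, and boundary edges: a west boundary edge at each vertex of column 1, an east one at each vertex of column $n+\lambda_1$, a north one at each vertex of row 1, a south one at each vertex of row $n$. A state places on every edge one hydrogen atom bonded to exactly one endpoint (for boundary edges: its grid vertex or the outside) so that every vertex is bonded to exactly two of the hydrogens on its four incident edges. The $\lambda$-boundary condition: all west and east boundary hydrogens are bonded to their grid vertex, no south boundary hydrogen is, and the north boundary hydrogen in column $c$ is bonded to $(1,c)$ iff $c\notin\{\lambda_k+n+1-k:1\le k\le n\}$. The weight of vertex $(r,c)$ is $x_r/a_c$ if its bonded hydrogens are on its north and south edges, $x_r/a_c-1$ if on its north and west edges, and $1$ otherwise. $Z_\lambda(x|a)$, with $x_1,\ldots,x_n,a_1,a_2,\ldots$ indeterminates, is the sum over all states with the $\lambda$-boundary condition of the product of all vertex weights. -}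

module Defs where

open import Level using (Level)
open import Data.Bool using (Bool; true; false; not; _∧_; if_then_else_)
open import Data.Nat using (ℕ; zero; suc; _+_; _≤_)
open import Data.Nat.Properties using (_≟_)
open import Data.Fin using (Fin; zero; suc; toℕ; inject₁; fromℕ)
import Data.Fin as F
open import Data.List using (List; []; _∷_; map; concatMap; foldr)
open import Data.Bool.ListAction using (any; all)
open import Data.List using (allFin)
open import Relation.Nullary.Decidable using (⌊_⌋)
open import Algebra.Bundles using (CommutativeRing)

allFuns : ∀ {a} {A : Set a} (k : ℕ) → List A → List (Fin k → A)
allFuns zero    xs = (λ ()) ∷ []
allFuns (suc k) xs =
  concatMap (λ x → map (λ f → λ { zero → x ; (suc i) → f i }) (allFuns k xs)) xs

bools : List Bool
bools = false ∷ true ∷ []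

-- A partition with n parts: weakly decreasing sequence of naturals
-- (λ i is the (i+1)-st part, 0-indexed).
IsPartition : ∀ {n} → (Fin n → ℕ) → Set
IsPartition {n} lam = ∀ (i j : Fin n) → i F.≤ j → lam j ≤ lam i

-- Number of bonded hydrogens (count of trues among four booleans)
count4 : Bool → Bool → Bool → Bool → ℕ
count4 a b c d = b2n a + b2n b + b2n c + b2n d
  where
  b2n : Bool → ℕ
  b2n true = 1
  b2n false = 0

module Model {c ℓ} (R : CommutativeRing c ℓ) where
  open CommutativeRing R using (Carrier; 0#; 1#)
    renaming (_+_ to _+R_; _*_ to _*R_; _-_ to _-R_)

  _^R_ : Carrier → ℕ → Carrier
  y ^R zero  = 1#
  y ^R suc k = y *R (y ^R k)

  sumL : List Carrier → Carrier
  sumL = foldr _+R_ 0#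

  prodFin : (k : ℕ) → (Fin k → Carrier) → Carrier
  prodFin zero    f = 1#
  prodFin (suc k) f = f zero *R prodFin k (λ i → f (suc i))

  -- Data: n = suc m rows, partition lam, N = n + lam₁ columns.
  -- Rows r : Fin n and columns col : Fin N are 0-indexed; the paper's
  -- row r+1 and column col+1.
  --
  -- Horizontal edges: h r j, j : Fin (suc N); j = 0 is the west boundary edge
  -- of row r, j = N the east boundary edge, j = col+1 (0<col+1<N) the edge
  -- between columns col and col+1.  h r j = true  means the hydrogen is
  -- bonded to the LEFT endpoint, false = to the RIGHT endpoint.
  -- Vertical edges: v i col, i : Fin (suc n); i = 0 north boundary, i = n south
  -- boundary.  v i col = true means bonded to the UPPER endpoint,
  -- false = to the LOWER endpoint.  (Outside counts as an endpoint.)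
  module _ (m : ℕ) (lam : Fin (suc m) → ℕ) where
    n : ℕ
    n = suc m

    N : ℕ
    N = n + lam zero

    -- 1-indexed column C lies in {λ_k + n + 1 - k : 1 ≤ k ≤ n}
    -- (with i = k - 1:  λ_i + n = C + i)
    inS : ℕ → Bool
    inS C = any (λ i → ⌊ lam i + n ≟ C + toℕ i ⌋) (allFin n)

    HEdges : Set
    HEdges = Fin n → Fin (suc N) → Bool

    VEdges : Set
    VEdges = Fin (suc n) → Fin N → Bool

    -- bondedness to the grid vertex (r,col)
    bW bE bN bS : HEdges → VEdges → Fin n → Fin N → Bool
    bW h v r col = not (h r (inject₁ col))
    bE h v r col = h r (suc col)
    bN h v r col = not (v (inject₁ r) col)
    bS h v r col = v (suc r) col

    validVertex : HEdges → VEdges → Fin n → Fin N → Bool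
    validVertex h v r col =
      ⌊ count4 (bW h v r col) (bE h v r col) (bN h v r col) (bS h v r col) ≟ 2 ⌋

    allB : (k : ℕ) → (Fin k → Bool) → Bool
    allB k f = all f (allFin k)

    lastRow : Fin n
    lastRow = fromℕ m

    lastCol : Fin N
    lastCol = fromℕ (m + lam zero)

    boundaryOK : HEdges → VEdges → Bool
    boundaryOK h v =
      allB n (λ r → bW h v r zero)
      ∧ allB n (λ r → bE h v r lastCol)
      ∧ allB N (λ col → not (bS h v lastRow col))
      ∧ allB N (λ col → eqB (bN h v zero col) (not (inS (suc (toℕ col)))))
        -- north boundary in (1-indexed) column C bonded to (1,C) iff C ∉ S
      where
      eqB : Bool → Bool → Bool
      eqB true  b = b
      eqB false b = not b

    isState : HEdges → VEdges → Bool
    isState h v = boundaryOK h v ∧ allB n (λ r → allB N (λ col → validVertex h v r col))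

    -- Vertex weight: xr = x_{r+1}, ainv = 1/a_{col+1};
    -- arguments: bonded on north, south, west, east edge.
    vertexWeight : Carrier → Carrier → Bool → Bool → Bool → Bool → Carrier
    vertexWeight xr ainv true true  false false = xr *R ainv
    vertexWeight xr ainv true false true  false = (xr *R ainv) -R 1#
    vertexWeight xr ainv _    _     _     _     = 1#

    -- x : Fin n → Carrier (x i = x_{i+1}); ainv : ℕ → Carrier (ainv C = 1/a_C, C ≥ 1)
    stateWeight : (Fin n → Carrier) → (ℕ → Carrier) → HEdges → VEdges → Carrier
    stateWeight x ainv h v =
      prodFin n (λ r → prodFin N (λ col →
        vertexWeight (x r) (ainv (suc (toℕ col)))
          (bN h v r col) (bS h v r col) (bW h v r col) (bE h v r col)))

    Z : (Fin n → Carrier) → (ℕ → Carrier) → Carrier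
    Z x ainv =
      sumL (concatMap (λ h → map (λ v →
                if isState h v then stateWeight x ainv h v else 0#)
              (allFuns (suc n) (allFuns N bools)))
           (allFuns n (allFuns (suc N) bools)))

    -- x^{-δ} = x_1^0 x_2^{-1} ... x_n^{-(n-1)}, given inverses xinv i = x_{i+1}^{-1}
    xNegδ : (Fin n → Carrier) → Carrier
    xNegδ xinv = prodFin n (λ i → xinv i ^R toℕ i)

    xNegδZ : (Fin n → Carrier) → (Fin n → Carrier) → (ℕ → Carrier) → Carrier
    xNegδZ x xinv ainv = xNegδ xinv *R Z x ainv

module Submission where

-- x^{-δ} Z_λ(x|a) is symmetric in x₁, …, x_n: the Yang–Baxter "train
-- argument" for the six-vertex model with λ-boundary condition.
--
-- Summing out the horizontal edges
--    of a grid row gives a row transfer matrix T(x_r) between consecutive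
--    rows of vertical edges, so that
--      Z_λ(x|a) = Σ_t [t meets the north boundary] · (T(x₁)⋯T(x_n)·south)(t).
-- 2. Exchange relation (module Rows).  An R-vertex attached on the west of
--    two stacked rows can be pushed column by column to the east, exchanging
--    the two spectral parameters (the Yang–Baxter equation, checked by the
--    ring solver in each of its 16 boundary cases).  On the domain-wall west
--    boundary it contributes x, on the east boundary y; hence
--      x · T(x)T(y) = y · T(y)T(x).
-- 3. Symmetrisation (module TransferChains, for an arbitrary transfer
--    matrix).  If consecutive factors satisfy the exchange relation, the
--    product in which the i-th factor is weighted by x_i^{-(i-1)} is invariant
--    under every permutation of the parameters (induction on a permutation
--    proof; an adjacent swap is the exchange relation divided by x·y).  This
--    weight is exactly x^{-δ}, which gives the theorem.

open import Defs
open import Level using (Level)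
open import Algebra.Bundles using (CommutativeRing)
open import Data.Bool using (Bool; true; false; not; _∧_; if_then_else_)
open import Data.Nat as ℕ using (ℕ; zero; suc)
open import Data.Nat.Properties using (_≟_)
open import Data.Fin using (Fin; zero; suc; toℕ; inject₁; fromℕ; punchIn)
open import Data.Fin.Permutation using (Permutation′; _⟨$⟩ʳ_; remove; punchIn-permute)
open import Data.List using (List; []; _∷_; map; concatMap; _++_; tabulate; allFin)
open import Data.List.Properties using (map-++; map-∘; tabulate-cong)
open import Data.List.Relation.Binary.Permutation.Propositional as ↭ using (_↭_)
open import Data.List.Relation.Binary.Permutation.Propositional.Properties using (All-resp-↭)
open import Data.List.Relation.Unary.All using (All; []; _∷_)
open import Data.List.Relation.Unary.All.Properties using (tabulate⁺)
open import Data.Bool.ListAction using (all)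
open import Data.Product using (_×_; _,_; proj₁; proj₂)
open import Data.Vec.Functional using (head; tail)
open import Relation.Binary.PropositionalEquality as PE using (_≡_)
open import Relation.Nullary.Decidable using (⌊_⌋)

-- The standard library only provides natural-number
-- coefficients for general rings, which cannot express the
-- cancellations (y − x, x·a⁻¹ − 1) occurring in the Yang–Baxter
-- equation; so we supply the canonical homomorphism ℤ → R.
module IntegerCoefficients {c ℓ} (R : CommutativeRing c ℓ) where
  open import Data.Maybe using (Maybe; just; nothing)
  open import Relation.Nullary using (yes; no)
  import Data.Nat.Properties as ℕP
  open import Data.Integer as ℤ using (ℤ; +_; -[1+_]; _⊖_; _◃_)
  import Data.Integer.Properties as ℤP
  open import Data.Sign as Sign using (Sign)
  open import Algebra.Solver.Ring.AlmostCommutativeRing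
    using (fromCommutativeRing; _-Raw-AlmostCommutative⟶_)
  open CommutativeRing R
  open import Algebra.Properties.Ring ring using (-‿distribˡ-*; -‿distribʳ-*)
  open import Algebra.Properties.AbelianGroup +-abelianGroup using (⁻¹-∙-comm)
  open import Algebra.Properties.Group +-group using (ε⁻¹≈ε; ⁻¹-involutive)
  open import Algebra.Properties.Semiring.Mult.TCOptimised semiring
    using (×-homo-+; ×1-homo-*) renaming (_×_ to _·_)
  open import Relation.Binary.Reasoning.Setoid setoid

  -- The optimised multiplication gives ⟦ + 0 ⟧ = 0# and ⟦ + 1 ⟧ = 1#
  -- definitionally, so solved equations match goals written with 0#, 1#.
  ⟦_⟧ℤ : ℤ → Carrier
  ⟦ + n ⟧ℤ      = n · 1#
  ⟦ -[1+ n ] ⟧ℤ = - (suc n · 1#)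

  suc-·1 : ∀ n → suc n · 1# ≈ 1# + n · 1#
  suc-·1 n = ×-homo-+ 1# 1 n

  cancel-1 : ∀ a b → (1# + a) - (1# + b) ≈ a - b
  cancel-1 a b = begin
    (1# + a) + - (1# + b)    ≈⟨ +-congˡ (⁻¹-∙-comm 1# b) ⟨
    (1# + a) + (- 1# + - b)  ≈⟨ +-congʳ (+-comm 1# a) ⟩
    (a + 1#) + (- 1# + - b)  ≈⟨ +-assoc a 1# _ ⟩
    a + (1# + (- 1# + - b))  ≈⟨ +-congˡ (+-assoc 1# (- 1#) (- b)) ⟨
    a + ((1# - 1#) + - b)    ≈⟨ +-congˡ (+-congʳ (-‿inverseʳ 1#)) ⟩
    a + (0# + - b)           ≈⟨ +-congˡ (+-identityˡ (- b)) ⟩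
    a - b                    ∎

  ⊖-hom : ∀ m n → ⟦ m ⊖ n ⟧ℤ ≈ m · 1# - n · 1#
  ⊖-hom m zero rewrite ℤP.⊖-≥ {m} {0} ℕ.z≤n = begin
    m · 1#          ≈⟨ +-identityʳ _ ⟨
    m · 1# + 0#     ≈⟨ +-congˡ ε⁻¹≈ε ⟨
    m · 1# - 0#     ∎
  ⊖-hom zero (suc n) rewrite ℤP.⊖-< {0} {suc n} (ℕ.s≤s ℕ.z≤n) = sym (+-identityˡ _)
  ⊖-hom (suc m) (suc n) rewrite ℤP.[1+m]⊖[1+n]≡m⊖n m n = begin
    ⟦ m ⊖ n ⟧ℤ                      ≈⟨ ⊖-hom m n ⟩
    m · 1# - n · 1#                 ≈⟨ cancel-1 _ _ ⟨
    (1# + m · 1#) - (1# + n · 1#)   ≈⟨ +-cong (suc-·1 m) (-‿cong (suc-·1 n)) ⟨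
    suc m · 1# - suc n · 1#         ∎

  signed : Sign → Carrier → Carrier
  signed Sign.+ a = a
  signed Sign.- a = - a

  ◃-hom : ∀ s k → ⟦ s ◃ k ⟧ℤ ≈ signed s (k · 1#)
  ◃-hom Sign.+ zero    = refl
  ◃-hom Sign.- zero    = sym ε⁻¹≈ε
  ◃-hom Sign.+ (suc k) = refl
  ◃-hom Sign.- (suc k) = refl

  +-hom : ∀ i j → ⟦ i ℤ.+ j ⟧ℤ ≈ ⟦ i ⟧ℤ + ⟦ j ⟧ℤ
  +-hom (+ m)    (+ n)    = ×-homo-+ 1# m n
  +-hom (+ m)    -[1+ n ] = ⊖-hom m (suc n)
  +-hom -[1+ m ] (+ n)    = trans (⊖-hom n (suc m)) (+-comm _ _)
  +-hom -[1+ m ] -[1+ n ] = begin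
    - (suc (suc (m ℕ.+ n)) · 1#)          ≡⟨ PE.cong (λ k → - (k · 1#)) (ℕP.+-suc (suc m) n) ⟨
    - ((suc m ℕ.+ suc n) · 1#)            ≈⟨ -‿cong (×-homo-+ 1# (suc m) (suc n)) ⟩
    - (suc m · 1# + suc n · 1#)           ≈⟨ ⁻¹-∙-comm _ _ ⟨
    - (suc m · 1#) + - (suc n · 1#)       ∎

  neg-hom : ∀ i → ⟦ ℤ.- i ⟧ℤ ≈ - ⟦ i ⟧ℤ
  neg-hom (+ zero)  = sym ε⁻¹≈ε
  neg-hom (+ suc n) = refl
  neg-hom -[1+ n ]  = sym (⁻¹-involutive _)

  *-hom : ∀ i j → ⟦ i ℤ.* j ⟧ℤ ≈ ⟦ i ⟧ℤ * ⟦ j ⟧ℤ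
  *-hom (+ m) (+ n) = trans (◃-hom Sign.+ (m ℕ.* n)) (×1-homo-* m n)
  *-hom (+ m) -[1+ n ] = begin
    ⟦ Sign.- ◃ (m ℕ.* suc n) ⟧ℤ      ≈⟨ ◃-hom Sign.- (m ℕ.* suc n) ⟩
    - ((m ℕ.* suc n) · 1#)           ≈⟨ -‿cong (×1-homo-* m (suc n)) ⟩
    - (m · 1# * suc n · 1#)          ≈⟨ -‿distribʳ-* _ _ ⟩
    m · 1# * - (suc n · 1#)          ∎
  *-hom -[1+ m ] (+ n) = begin
    ⟦ Sign.- ◃ (suc m ℕ.* n) ⟧ℤ      ≈⟨ ◃-hom Sign.- (suc m ℕ.* n) ⟩
    - ((suc m ℕ.* n) · 1#)           ≈⟨ -‿cong (×1-homo-* (suc m) n) ⟩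
    - (suc m · 1# * n · 1#)          ≈⟨ -‿distribˡ-* _ _ ⟩
    - (suc m · 1#) * n · 1#          ∎
  *-hom -[1+ m ] -[1+ n ] = begin
    ⟦ Sign.+ ◃ (suc m ℕ.* suc n) ⟧ℤ  ≈⟨ ◃-hom Sign.+ (suc m ℕ.* suc n) ⟩
    (suc m ℕ.* suc n) · 1#           ≈⟨ ×1-homo-* (suc m) (suc n) ⟩
    suc m · 1# * suc n · 1#          ≈⟨ ⁻¹-involutive _ ⟨
    - - (suc m · 1# * suc n · 1#)    ≈⟨ -‿cong (-‿distribʳ-* _ _) ⟩
    - (suc m · 1# * - (suc n · 1#))  ≈⟨ -‿distribˡ-* _ _ ⟩
    - (suc m · 1#) * - (suc n · 1#)  ∎

  ℤ⟶R : ℤ.+-*-rawRing -Raw-AlmostCommutative⟶ fromCommutativeRing R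
  ℤ⟶R = record
    { ⟦_⟧ = ⟦_⟧ℤ ; +-homo = +-hom ; *-homo = *-hom ; -‿homo = neg-hom
    ; 0-homo = refl ; 1-homo = refl }

  ℤ-equal? : ∀ i j → Maybe (⟦ i ⟧ℤ ≈ ⟦ j ⟧ℤ)
  ℤ-equal? i j with i ℤ.≟ j
  ... | yes PE.refl = just refl
  ... | no _        = nothing

  open import Algebra.Solver.Ring ℤ.+-*-rawRing (fromCommutativeRing R) ℤ⟶R ℤ-equal? public
    using (solve; _:=_; _:+_; _:*_; _:-_; con; Polynomial)

module Sums {c ℓ} (R : CommutativeRing c ℓ) where
  open CommutativeRing R hiding (zero)
  open Model R using (sumL; prodFin)
  open import Relation.Binary.Reasoning.Setoid setoid
  open import Algebra.Properties.CommutativeSemigroup +-commutativeSemigroup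
    using () renaming (x∙yz≈y∙xz to +-leftComm)
  open import Algebra.Properties.CommutativeSemigroup *-commutativeSemigroup
    using () renaming (interchange to *-interchange)

  private variable
    a b : Level
    A : Set a
    B : Set b

  ∑ : List A → (A → Carrier) → Carrier
  ∑ l f = sumL (map f l)

  ∑𝔹 : (Bool → Carrier) → Carrier
  ∑𝔹 f = f false + f true

  ∑-cong : ∀ (l : List A) {f g : A → Carrier} → (∀ z → f z ≈ g z) → ∑ l f ≈ ∑ l g
  ∑-cong []      f≈g = refl
  ∑-cong (z ∷ l) f≈g = +-cong (f≈g z) (∑-cong l f≈g)

  ∑-*ˡ : ∀ (l : List A) k (f : A → Carrier) → k * ∑ l f ≈ ∑ l (λ z → k * f z)
  ∑-*ˡ []      k f = zeroʳ k
  ∑-*ˡ (z ∷ l) k f = trans (distribˡ _ _ _) (+-congˡ (∑-*ˡ l k f))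

  ∑-*ʳ : ∀ (l : List A) k (f : A → Carrier) → ∑ l f * k ≈ ∑ l (λ z → f z * k)
  ∑-*ʳ l k f = trans (*-comm _ _) (trans (∑-*ˡ l k f) (∑-cong l (λ z → *-comm k (f z))))

  ∑-+ : ∀ (l : List A) (f g : A → Carrier) → ∑ l (λ z → f z + g z) ≈ ∑ l f + ∑ l g
  ∑-+ []      f g = sym (+-identityˡ _)
  ∑-+ (z ∷ l) f g = begin
    (f z + g z) + ∑ l (λ z → f z + g z)  ≈⟨ +-congˡ (∑-+ l f g) ⟩
    (f z + g z) + (∑ l f + ∑ l g)        ≈⟨ +-assoc _ _ _ ⟩
    f z + (g z + (∑ l f + ∑ l g))        ≈⟨ +-congˡ (+-leftComm _ _ _) ⟩
    f z + (∑ l f + (g z + ∑ l g))        ≈⟨ +-assoc _ _ _ ⟨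
    (f z + ∑ l f) + (g z + ∑ l g)        ∎

  ∑-zero : ∀ (l : List A) → ∑ l (λ _ → 0#) ≈ 0#
  ∑-zero []      = refl
  ∑-zero (z ∷ l) = trans (+-identityˡ _) (∑-zero l)

  ∑-comm : ∀ (l : List A) (l′ : List B) (F : A → B → Carrier) →
    ∑ l (λ u → ∑ l′ (F u)) ≈ ∑ l′ (λ w → ∑ l (λ u → F u w))
  ∑-comm []      l′ F = sym (∑-zero l′)
  ∑-comm (u ∷ l) l′ F = trans (+-congˡ (∑-comm l l′ F)) (sym (∑-+ l′ (F u) _))

  sumL-++ : ∀ (xs ys : List Carrier) → sumL (xs ++ ys) ≈ sumL xs + sumL ys
  sumL-++ []       ys = sym (+-identityˡ _)
  sumL-++ (x ∷ xs) ys = trans (+-congˡ (sumL-++ xs ys)) (sym (+-assoc _ _ _))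

  ∑-concatMap : ∀ (H : A → List Carrier) (l : List A) →
    sumL (concatMap H l) ≈ ∑ l (λ z → sumL (H z))
  ∑-concatMap H []      = refl
  ∑-concatMap H (z ∷ l) = trans (sumL-++ (H z) (concatMap H l)) (+-congˡ (∑-concatMap H l))

  ∑-bools : ∀ (f : Bool → Carrier) → ∑ bools f ≈ ∑𝔹 f
  ∑-bools f = +-congˡ (+-identityʳ _)

  ∑𝔹-cong : ∀ {f g : Bool → Carrier} → (∀ b → f b ≈ g b) → ∑𝔹 f ≈ ∑𝔹 g
  ∑𝔹-cong f≈g = +-cong (f≈g false) (f≈g true)

  ∑-allFuns-suc : ∀ k (xs : List A) (F : (Fin (suc k) → A) → Carrier)
    (G : A → (Fin k → A) → Carrier) → (∀ g → F g ≈ G (head g) (tail g)) →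
    ∑ (allFuns (suc k) xs) F ≈ ∑ xs (λ z → ∑ (allFuns k xs) (G z))
  ∑-allFuns-suc {A = A} k xs F G F≈G = begin
    sumL (map F (concatMap _ xs))                  ≡⟨ PE.cong sumL (map-concatMap xs) ⟩
    sumL (concatMap _ xs)                          ≈⟨ ∑-concatMap _ xs ⟩
    ∑ xs (λ z → sumL (map F (map _ (allFuns k xs))))
      ≈⟨ ∑-cong xs (λ z → reflexive (PE.cong sumL (PE.sym (map-∘ (allFuns k xs))))) ⟩
    ∑ xs (λ z → ∑ (allFuns k xs) _)                ≈⟨ ∑-cong xs (λ z → ∑-cong (allFuns k xs) (λ g → F≈G _)) ⟩
    ∑ xs (λ z → ∑ (allFuns k xs) (G z))            ∎
    where
    map-concatMap : ∀ {b} {B : Set b} {H : B → List (Fin (suc k) → A)} (l : List B) →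
      map F (concatMap H l) ≡ concatMap (λ z → map F (H z)) l
    map-concatMap []      = PE.refl
    map-concatMap {H = H} (z ∷ l) =
      PE.trans (map-++ F (H z) (concatMap H l)) (PE.cong (map F (H z) ++_) (map-concatMap l))

  ind : Bool → Carrier
  ind true  = 1#
  ind false = 0#

  ind-∧ : ∀ p q → ind (p ∧ q) ≈ ind p * ind q
  ind-∧ true  q = sym (*-identityˡ _)
  ind-∧ false q = sym (zeroˡ _)

  if-as-ind : ∀ p w → (if p then w else 0#) ≈ ind p * w
  if-as-ind true  w = sym (*-identityˡ _)
  if-as-ind false w = sym (zeroˡ _)

  prodFin-cong : ∀ k {f g : Fin k → Carrier} → (∀ i → f i ≈ g i) → prodFin k f ≈ prodFin k g
  prodFin-cong zero    f≈g = refl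
  prodFin-cong (suc k) f≈g = *-cong (f≈g zero) (prodFin-cong k (λ i → f≈g (suc i)))

  prodFin-* : ∀ k (f g : Fin k → Carrier) →
    prodFin k (λ i → f i * g i) ≈ prodFin k f * prodFin k g
  prodFin-* zero    f g = sym (*-identityˡ _)
  prodFin-* (suc k) f g = trans (*-congˡ (prodFin-* k (tail f) (tail g)))
                                (sym (*-interchange _ _ _ _))

  ind-all-tabulate : ∀ {a} {A : Set a} k (p : A → Bool) (g : Fin k → A) →
    ind (all p (tabulate g)) ≈ prodFin k (λ i → ind (p (g i)))
  ind-all-tabulate zero    p g = refl
  ind-all-tabulate (suc k) p g = trans (ind-∧ (p (g zero)) _) (*-congˡ (ind-all-tabulate k p (tail g)))

tabulate-extract : ∀ {a} {A : Set a} n (k : Fin (suc n)) (f : Fin (suc n) → A) →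
  tabulate f ↭ f k ∷ tabulate (λ j → f (punchIn k j))
tabulate-extract n       zero    f = ↭.refl
tabulate-extract (suc n) (suc k) f =
  ↭.trans (↭.prep (head f) (tabulate-extract n k (tail f))) (↭.swap (head f) (f (suc k)) ↭.refl)

tabulate-permute : ∀ {a} {A : Set a} n (σ : Permutation′ n) (f : Fin n → A) →
  tabulate (λ i → f (σ ⟨$⟩ʳ i)) ↭ tabulate f
tabulate-permute zero    σ f = ↭.refl
tabulate-permute (suc n) σ f = begin
  f (σ ⟨$⟩ʳ zero) ∷ tabulate (λ i → f (σ ⟨$⟩ʳ suc i))
    ≡⟨ PE.cong (_ ∷_) (tabulate-cong (λ i → PE.cong f (punchIn-permute σ zero i))) ⟩
  f σ₀ ∷ tabulate (λ i → f (punchIn σ₀ (remove zero σ ⟨$⟩ʳ i)))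
    ↭⟨ ↭.prep (f σ₀) (tabulate-permute n (remove zero σ) (λ j → f (punchIn σ₀ j))) ⟩
  f σ₀ ∷ tabulate (λ j → f (punchIn σ₀ j))
    ↭⟨ tabulate-extract n σ₀ f ⟨
  tabulate f ∎
  where
  open ↭.PermutationReasoning
  σ₀ : Fin (suc n)
  σ₀ = σ ⟨$⟩ʳ zero

-- If any two
-- consecutive factors satisfy the exchange relation x·T(x)T(y) = y·T(y)T(x),
-- then the "twisted" chain, in which the i-th factor is weighted by
-- x_i^{-(i-1)}, is invariant under permutations of the parameters.
module TransferChains {c ℓ} (R : CommutativeRing c ℓ) {s} {State : Set s}
  (states : List State)
  (T : CommutativeRing.Carrier R → State → State → CommutativeRing.Carrier R)
  (south : State → CommutativeRing.Carrier R) where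

  open CommutativeRing R hiding (zero)
  open Model R using (prodFin; _^R_)
  open Sums R
  open import Relation.Binary.Reasoning.Setoid setoid
  open import Algebra.Properties.CommutativeSemigroup *-commutativeSemigroup
    using () renaming (x∙yz≈y∙xz to *-leftComm; interchange to *-interchange)

  T² : Carrier → Carrier → State → State → Carrier
  T² x y t b = ∑ states (λ mid → T x t mid * T y mid b)

  chain : List Carrier → State → Carrier
  chain []       t = south t
  chain (x ∷ xs) t = ∑ states (λ b → T x t b * chain xs b)

  Invertible : Carrier × Carrier → Set ℓ
  Invertible (x , x⁻¹) = x * x⁻¹ ≈ 1#

  invProd : List (Carrier × Carrier) → Carrier
  invProd []       = 1#
  invProd (p ∷ ps) = proj₂ p * invProd ps

  -- The twisted chain: at each factor the inverses of all later parameters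
  -- are collected, so the i-th parameter enters with weight x_i^{-(i-1)}.
  twisted : List (Carrier × Carrier) → State → Carrier
  twisted []       t = south t
  twisted (p ∷ ps) t = invProd ps * ∑ states (λ b → T (proj₁ p) t b * twisted ps b)

  invProd-tabulate : ∀ k (y y⁻¹ : Fin k → Carrier) →
    prodFin k y⁻¹ ≈ invProd (tabulate (λ i → y i , y⁻¹ i))
  invProd-tabulate zero    y y⁻¹ = refl
  invProd-tabulate (suc k) y y⁻¹ = *-congˡ (invProd-tabulate k (tail y) (tail y⁻¹))

  twisted-tabulate : ∀ j (x x⁻¹ : Fin j → Carrier) t →
    prodFin j (λ i → x⁻¹ i ^R toℕ i) * chain (tabulate x) t ≈ twisted (tabulate (λ i → x i , x⁻¹ i)) t
  twisted-tabulate zero    x x⁻¹ t = *-identityˡ _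
  twisted-tabulate (suc j) x x⁻¹ t = begin
    (1# * δ′) * ∑ states (λ b → T (head x) t b * chain (tabulate (tail x)) b)
      ≈⟨ *-congʳ (trans (*-identityˡ _) (prodFin-* j (tail x⁻¹) _)) ⟩
    (Π′ * δ″) * ∑ states (λ b → T (head x) t b * chain (tabulate (tail x)) b)
      ≈⟨ trans (*-assoc _ _ _) (*-congˡ (∑-*ˡ states δ″ _)) ⟩
    Π′ * ∑ states (λ b → δ″ * (T (head x) t b * chain (tabulate (tail x)) b))
      ≈⟨ *-cong (invProd-tabulate j (tail x) (tail x⁻¹))
                (∑-cong states (λ b → trans (*-leftComm _ _ _)
                  (*-congˡ (twisted-tabulate j (tail x) (tail x⁻¹) b)))) ⟩
    twisted (tabulate (λ i → x i , x⁻¹ i)) t ∎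
    where
    -- x^{-δ} = (x₂⋯x_{j+1})⁻¹ · (x₂,…,x_{j+1})^{-δ}
    δ′ Π′ δ″ : Carrier
    δ′ = prodFin j (λ i → x⁻¹ (suc i) ^R suc (toℕ i))
    Π′ = prodFin j (tail x⁻¹)
    δ″ = prodFin j (λ i → tail x⁻¹ i ^R toℕ i)

  invProd-↭ : ∀ {ps qs} → ps ↭ qs → invProd ps ≈ invProd qs
  invProd-↭ ↭.refl             = refl
  invProd-↭ (↭.prep p ps↭qs)   = *-congˡ (invProd-↭ ps↭qs)
  invProd-↭ (↭.swap p q ps↭qs) = trans (*-leftComm _ _ _) (*-congˡ (*-congˡ (invProd-↭ ps↭qs)))
  invProd-↭ (↭.trans p↭q q↭r)  = trans (invProd-↭ p↭q) (invProd-↭ q↭r)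

  twisted-two : ∀ p q ps t → twisted (p ∷ q ∷ ps) t ≈
    invProd ps * (invProd ps * ∑ states (λ b → (proj₂ q * T² (proj₁ p) (proj₁ q) t b) * twisted ps b))
  twisted-two (x , _) (y , y⁻¹) ps t = begin
    (y⁻¹ * π) * ∑ states (λ m → T x t m * (π * ∑ states (λ b → T y m b * E b)))
      ≈⟨ *-congˡ (∑-cong states (λ m → trans (*-leftComm _ π _) (*-congˡ (∑-*ˡ states (T x t m) _)))) ⟩
    (y⁻¹ * π) * ∑ states (λ m → π * ∑ states (λ b → T x t m * (T y m b * E b)))
      ≈⟨ *-congˡ (sym (∑-*ˡ states π _)) ⟩
    (y⁻¹ * π) * (π * ∑ states (λ m → ∑ states (λ b → T x t m * (T y m b * E b))))
      ≈⟨ *-congˡ (*-congˡ (∑-comm states states _)) ⟩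
    (y⁻¹ * π) * (π * ∑ states (λ b → ∑ states (λ m → T x t m * (T y m b * E b))))
      ≈⟨ *-congˡ (*-congˡ (∑-cong states (λ b → trans (∑-cong states (λ m → sym (*-assoc _ _ _)))
                                                      (sym (∑-*ʳ states (E b) _))))) ⟩
    (y⁻¹ * π) * (π * ∑ states (λ b → T² x y t b * E b))
      ≈⟨ trans (*-assoc _ _ _) (*-leftComm _ _ _) ⟩
    π * (y⁻¹ * (π * ∑ states (λ b → T² x y t b * E b)))
      ≈⟨ *-congˡ (*-leftComm _ _ _) ⟩
    π * (π * (y⁻¹ * ∑ states (λ b → T² x y t b * E b)))
      ≈⟨ *-congˡ (*-congˡ (trans (∑-*ˡ states y⁻¹ _) (∑-cong states (λ b → sym (*-assoc _ _ _))))) ⟩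
    π * (π * ∑ states (λ b → (y⁻¹ * T² x y t b) * E b)) ∎
    where
    π : Carrier
    π = invProd ps
    E : State → Carrier
    E = twisted ps

  module _ (exchange : ∀ x y t b → x * T² x y t b ≈ y * T² y x t b) where

    -- the exchange relation, divided by x·y
    exchange⁻¹ : ∀ p q → Invertible p → Invertible q → ∀ t b →
      proj₂ q * T² (proj₁ p) (proj₁ q) t b ≈ proj₂ p * T² (proj₁ q) (proj₁ p) t b
    exchange⁻¹ (x , x⁻¹) (y , y⁻¹) xx⁻¹≈1 yy⁻¹≈1 t b = begin
      y⁻¹ * T² x y t b                   ≈⟨ *-identityˡ _ ⟨
      1# * (y⁻¹ * T² x y t b)            ≈⟨ *-congʳ xx⁻¹≈1 ⟨
      (x * x⁻¹) * (y⁻¹ * T² x y t b)     ≈⟨ *-congʳ (*-comm x x⁻¹) ⟩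
      (x⁻¹ * x) * (y⁻¹ * T² x y t b)     ≈⟨ *-interchange x⁻¹ x y⁻¹ _ ⟩
      (x⁻¹ * y⁻¹) * (x * T² x y t b)     ≈⟨ *-congˡ (exchange x y t b) ⟩
      (x⁻¹ * y⁻¹) * (y * T² y x t b)     ≈⟨ *-assoc _ _ _ ⟩
      x⁻¹ * (y⁻¹ * (y * T² y x t b))     ≈⟨ *-congˡ (sym (*-assoc _ _ _)) ⟩
      x⁻¹ * ((y⁻¹ * y) * T² y x t b)     ≈⟨ *-congˡ (*-congʳ (trans (*-comm y⁻¹ y) yy⁻¹≈1)) ⟩
      x⁻¹ * (1# * T² y x t b)            ≈⟨ *-congˡ (*-identityˡ _) ⟩
      x⁻¹ * T² y x t b                   ∎

    twisted-↭ : ∀ {ps qs} → ps ↭ qs → All Invertible ps → ∀ t → twisted ps t ≈ twisted qs t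
    twisted-↭ ↭.refl inv t = refl
    twisted-↭ (↭.prep p ps↭qs) (_ ∷ inv) t =
      *-cong (invProd-↭ ps↭qs) (∑-cong states (λ b → *-congˡ (twisted-↭ ps↭qs inv b)))
    twisted-↭ {p ∷ q ∷ ps} {.q ∷ .p ∷ qs} (↭.swap p q ps↭qs) (p-inv ∷ q-inv ∷ inv) t = begin
      twisted (p ∷ q ∷ ps) t
        ≈⟨ twisted-two p q ps t ⟩
      invProd ps * (invProd ps * ∑ states (λ b → (proj₂ q * T² (proj₁ p) (proj₁ q) t b) * twisted ps b))
        ≈⟨ *-cong (invProd-↭ ps↭qs) (*-cong (invProd-↭ ps↭qs) (∑-cong states (λ b →
             *-cong (exchange⁻¹ p q p-inv q-inv t b) (twisted-↭ ps↭qs inv b)))) ⟩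
      invProd qs * (invProd qs * ∑ states (λ b → (proj₂ p * T² (proj₁ q) (proj₁ p) t b) * twisted qs b))
        ≈⟨ twisted-two q p qs t ⟨
      twisted (q ∷ p ∷ qs) t ∎
    twisted-↭ (↭.trans p↭q q↭r) inv t =
      trans (twisted-↭ p↭q inv t) (twisted-↭ q↭r (All-resp-↭ p↭q inv) t)

-- Edge values are the raw booleans of Defs: a horizontal edge is true when
-- its hydrogen sits at the left endpoint, a vertical edge when it sits at
-- the upper endpoint.  A single row of k vertices with spectral parameter
-- x, north edges t, south edges b and west edge w is summed over its
-- interior horizontal edges; the east boundary is a weight function.
-- (Defs fixes the vertex weights inside a module parametrised by the
-- partition, hence the parameters m and lam, which are otherwise unused.)
module Rows {c ℓ} (R : CommutativeRing c ℓ) (m : ℕ) (lam : Fin (suc m) → ℕ) where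
  open CommutativeRing R hiding (zero)
  open Sums R
  open Model R using (prodFin)
  open IntegerCoefficients R
  open import Data.Integer using (+_)
  open import Relation.Binary.Reasoning.Setoid setoid
  open import Algebra.Properties.CommutativeSemigroup *-commutativeSemigroup
    using () renaming (x∙yz≈y∙xz to *-leftComm)

  -- Boltzmann weight of a vertex with west, north, south, east edge values,
  -- with the ice rule (two hydrogens per vertex) built in.
  vertex : (x a⁻¹ : Carrier) (w n s e : Bool) → Carrier
  vertex x a⁻¹ w n s e =
    ind ⌊ count4 (not w) e (not n) s ≟ 2 ⌋ * Model.vertexWeight R m lam x a⁻¹ (not n) s (not w) e

  -- Row transfer: column j of the row has parameter a_j⁻¹ = a⁻¹ j (j ≥ 1).
  row : (x : Carrier) (a⁻¹ : ℕ → Carrier) (k : ℕ) (w : Bool) (east : Bool → Carrier)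
    (t b : Fin k → Bool) → Carrier
  row x a⁻¹ zero    w east t b = east w
  row x a⁻¹ (suc k) w east t b = ∑𝔹 λ e →
    vertex x (a⁻¹ 1) w (head t) (head b) e * row x (λ j → a⁻¹ (suc j)) k e east (tail t) (tail b)

  column : (x y a⁻¹ : Carrier) (w₁ w₂ n s : Bool) (F : Bool → Bool → Carrier) → Carrier
  column x y a⁻¹ w₁ w₂ n s F = ∑𝔹 λ mid → ∑𝔹 λ e₁ → ∑𝔹 λ e₂ →
    (vertex x a⁻¹ w₁ n mid e₁ * vertex y a⁻¹ w₂ mid s e₂) * F e₁ e₂

  doubleRow : (x y : Carrier) (a⁻¹ : ℕ → Carrier) (k : ℕ) (w₁ w₂ : Bool)
    (east : Bool → Bool → Carrier) (t b : Fin k → Bool) → Carrier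
  doubleRow x y a⁻¹ zero    w₁ w₂ east t b = east w₁ w₂
  doubleRow x y a⁻¹ (suc k) w₁ w₂ east t b = column x y (a⁻¹ 1) w₁ w₂ (head t) (head b) λ e₁ e₂ →
    doubleRow x y (λ j → a⁻¹ (suc j)) k e₁ e₂ east (tail t) (tail b)

  expand-product : ∀ c₀ c₁ d₀ d₁ x₀ x₁ y₀ y₁ → (c₀ * x₀ + c₁ * x₁) * (d₀ * y₀ + d₁ * y₁) ≈
    ((c₀ * d₀) * (x₀ * y₀) + (c₀ * d₁) * (x₀ * y₁)) + ((c₁ * d₀) * (x₁ * y₀) + (c₁ * d₁) * (x₁ * y₁))
  expand-product = solve 8 (λ c₀ c₁ d₀ d₁ x₀ x₁ y₀ y₁ →
    (c₀ :* x₀ :+ c₁ :* x₁) :* (d₀ :* y₀ :+ d₁ :* y₁) :=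
    ((c₀ :* d₀) :* (x₀ :* y₀) :+ (c₀ :* d₁) :* (x₀ :* y₁)) :+ ((c₁ :* d₀) :* (x₁ :* y₀) :+ (c₁ :* d₁) :* (x₁ :* y₁)))
    refl

  ∑-∑𝔹-∑𝔹 : ∀ {a} {A : Set a} (l : List A) (c d : Bool → Carrier) (X Y : Bool → A → Carrier) →
    ∑ l (λ z → ∑𝔹 (λ e₁ → c e₁ * X e₁ z) * ∑𝔹 (λ e₂ → d e₂ * Y e₂ z)) ≈
    ∑𝔹 λ e₁ → ∑𝔹 λ e₂ → (c e₁ * d e₂) * ∑ l (λ z → X e₁ z * Y e₂ z)
  ∑-∑𝔹-∑𝔹 {A = A} l c d X Y = begin
    ∑ l (λ z → ∑𝔹 (λ e₁ → c e₁ * X e₁ z) * ∑𝔹 (λ e₂ → d e₂ * Y e₂ z))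
      ≈⟨ ∑-cong l (λ z → expand-product (c false) (c true) (d false) (d true)
                                         (X false z) (X true z) (Y false z) (Y true z)) ⟩
    ∑ l (λ z → (term false false z + term false true z) + (term true false z + term true true z))
      ≈⟨ trans (∑-+ l _ _) (+-cong (∑-+ l _ _) (∑-+ l _ _)) ⟩
    (∑ l (term false false) + ∑ l (term false true)) + (∑ l (term true false) + ∑ l (term true true))
      ≈⟨ +-cong (+-cong (sym (∑-*ˡ l _ _)) (sym (∑-*ˡ l _ _))) (+-cong (sym (∑-*ˡ l _ _)) (sym (∑-*ˡ l _ _))) ⟩
    ∑𝔹 (λ e₁ → ∑𝔹 (λ e₂ → (c e₁ * d e₂) * ∑ l (λ z → X e₁ z * Y e₂ z))) ∎
    where
    term : Bool → Bool → A → Carrier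
    term e₁ e₂ z = (c e₁ * d e₂) * (X e₁ z * Y e₂ z)

  column-cong : ∀ x y a⁻¹ w₁ w₂ n s {F G : Bool → Bool → Carrier} → (∀ e₁ e₂ → F e₁ e₂ ≈ G e₁ e₂) →
    column x y a⁻¹ w₁ w₂ n s F ≈ column x y a⁻¹ w₁ w₂ n s G
  column-cong x y a⁻¹ w₁ w₂ n s F≈G =
    ∑𝔹-cong λ mid → ∑𝔹-cong λ e₁ → ∑𝔹-cong λ e₂ → *-congˡ {vertices mid e₁ e₂} (F≈G e₁ e₂)
    where
    vertices : Bool → Bool → Bool → Carrier
    vertices mid e₁ e₂ = vertex x a⁻¹ w₁ n mid e₁ * vertex y a⁻¹ w₂ mid s e₂

  row-row : ∀ x y k a⁻¹ w₁ w₂ (E₁ E₂ : Bool → Carrier) t b →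
    ∑ (allFuns k bools) (λ mid → row x a⁻¹ k w₁ E₁ t mid * row y a⁻¹ k w₂ E₂ mid b) ≈
    doubleRow x y a⁻¹ k w₁ w₂ (λ e₁ e₂ → E₁ e₁ * E₂ e₂) t b
  row-row x y zero    a⁻¹ w₁ w₂ E₁ E₂ t b = +-identityʳ _
  row-row x y (suc k) a⁻¹ w₁ w₂ E₁ E₂ t b = begin
    ∑ (allFuns (suc k) bools) (λ mid → row x a⁻¹ (suc k) w₁ E₁ t mid * row y a⁻¹ (suc k) w₂ E₂ mid b)
      ≈⟨ ∑-allFuns-suc k bools _ (λ n f → ∑𝔹 (λ e → top n e * X e f) * ∑𝔹 (λ e → bot n e * Y e f)) (λ _ → refl) ⟩
    ∑ bools (λ n → ∑ (allFuns k bools) (λ f → ∑𝔹 (λ e → top n e * X e f) * ∑𝔹 (λ e → bot n e * Y e f)))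
      ≈⟨ ∑-bools (λ n → ∑ (allFuns k bools) (λ f → ∑𝔹 (λ e → top n e * X e f) * ∑𝔹 (λ e → bot n e * Y e f))) ⟩
    ∑𝔹 (λ n → ∑ (allFuns k bools) (λ f → ∑𝔹 (λ e → top n e * X e f) * ∑𝔹 (λ e → bot n e * Y e f)))
      ≈⟨ ∑𝔹-cong (λ n → ∑-∑𝔹-∑𝔹 (allFuns k bools) (top n) (bot n) X Y) ⟩
    ∑𝔹 (λ n → ∑𝔹 λ e₁ → ∑𝔹 λ e₂ → (top n e₁ * bot n e₂) * ∑ (allFuns k bools) (λ f → X e₁ f * Y e₂ f))
      ≈⟨ column-cong x y (a⁻¹ 1) w₁ w₂ (head t) (head b) (λ e₁ e₂ →
           row-row x y k a⁻¹′ e₁ e₂ E₁ E₂ (tail t) (tail b)) ⟩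
    doubleRow x y a⁻¹ (suc k) w₁ w₂ (λ e₁ e₂ → E₁ e₁ * E₂ e₂) t b ∎
    where
    a⁻¹′ : ℕ → Carrier
    a⁻¹′ j = a⁻¹ (suc j)
    top bot : Bool → Bool → Carrier
    top n e = vertex x (a⁻¹ 1) w₁ (head t) n e
    bot n e = vertex y (a⁻¹ 1) w₂ n (head b) e
    X Y : Bool → (Fin k → Bool) → Carrier
    X e f = row x a⁻¹′ k e E₁ (tail t) f
    Y e f = row y a⁻¹′ k e E₂ f (tail b)

  column-*ˡ : ∀ x y a⁻¹ w₁ w₂ n s k (F : Bool → Bool → Carrier) →
    column x y a⁻¹ w₁ w₂ n s (λ e₁ e₂ → k * F e₁ e₂) ≈ k * column x y a⁻¹ w₁ w₂ n s F
  column-*ˡ x y a⁻¹ w₁ w₂ n s k F = sym (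
    trans (distribˡ k _ _) (∑𝔹-cong λ mid →
    trans (distribˡ k _ _) (∑𝔹-cong λ e₁ →
    trans (distribˡ k _ _) (∑𝔹-cong λ e₂ → *-leftComm k (vertices mid e₁ e₂) (F e₁ e₂)))))
    where
    vertices : Bool → Bool → Bool → Carrier
    vertices mid e₁ e₂ = vertex x a⁻¹ w₁ n mid e₁ * vertex y a⁻¹ w₂ mid s e₂

  doubleRow-cong : ∀ x y a⁻¹ k w₁ w₂ {E E′ : Bool → Bool → Carrier} t b →
    (∀ e₁ e₂ → E e₁ e₂ ≈ E′ e₁ e₂) → doubleRow x y a⁻¹ k w₁ w₂ E t b ≈ doubleRow x y a⁻¹ k w₁ w₂ E′ t b
  doubleRow-cong x y a⁻¹ zero    w₁ w₂ t b E≈E′ = E≈E′ w₁ w₂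
  doubleRow-cong x y a⁻¹ (suc k) w₁ w₂ t b E≈E′ = column-cong x y (a⁻¹ 1) w₁ w₂ (head t) (head b)
    (λ e₁ e₂ → doubleRow-cong x y (λ j → a⁻¹ (suc j)) k e₁ e₂ (tail t) (tail b) E≈E′)

  doubleRow-*ˡ : ∀ x y a⁻¹ k w₁ w₂ c (E : Bool → Bool → Carrier) t b →
    doubleRow x y a⁻¹ k w₁ w₂ (λ e₁ e₂ → c * E e₁ e₂) t b ≈ c * doubleRow x y a⁻¹ k w₁ w₂ E t b
  doubleRow-*ˡ x y a⁻¹ zero    w₁ w₂ c E t b = refl
  doubleRow-*ˡ x y a⁻¹ (suc k) w₁ w₂ c E t b = trans
    (column-cong x y (a⁻¹ 1) w₁ w₂ (head t) (head b) (λ e₁ e₂ →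
      doubleRow-*ˡ x y (λ j → a⁻¹ (suc j)) k e₁ e₂ c E (tail t) (tail b)))
    (column-*ˡ x y (a⁻¹ 1) w₁ w₂ (head t) (head b) c (λ e₁ e₂ →
      doubleRow x y (λ j → a⁻¹ (suc j)) k e₁ e₂ E (tail t) (tail b)))

  rVertex : (x y : Carrier) (w₁ w₂ e₁ e₂ : Bool) → Carrier
  rVertex x y false false false false = x
  rVertex x y false true  false true  = x
  rVertex x y false true  true  false = y - x
  rVertex x y true  false true  false = y
  rVertex x y true  true  true  true  = y
  rVertex x y _     _     _     _     = 0#

  attachR : (x y : Carrier) (w₁ w₂ : Bool) (F : Bool → Bool → Carrier) → Carrier
  attachR x y w₁ w₂ F = ∑𝔹 λ h₁ → ∑𝔹 λ h₂ → rVertex x y w₁ w₂ h₁ h₂ * F h₁ h₂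

  -- The same weights as polynomials, so that identities between them can
  -- be handed to the ring solver (once all edge values are concrete).
  module Symbolic {k : ℕ} where
    indₚ : Bool → Polynomial k
    indₚ true  = con (+ 1)
    indₚ false = con (+ 0)

    vertexWeightₚ : (X A : Polynomial k) → Bool → Bool → Bool → Bool → Polynomial k
    vertexWeightₚ X A true true  false false = X :* A
    vertexWeightₚ X A true false true  false = X :* A :- con (+ 1)
    vertexWeightₚ X A _    _     _     _     = con (+ 1)

    vertexₚ : (X A : Polynomial k) (w n s e : Bool) → Polynomial k
    vertexₚ X A w n s e = indₚ ⌊ count4 (not w) e (not n) s ≟ 2 ⌋ :* vertexWeightₚ X A (not n) s (not w) e

    ∑𝔹ₚ : (Bool → Polynomial k) → Polynomial k
    ∑𝔹ₚ f = f false :+ f true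

    columnₚ : (X Y A : Polynomial k) (w₁ w₂ n s : Bool) (F : Bool → Bool → Polynomial k) → Polynomial k
    columnₚ X Y A w₁ w₂ n s F = ∑𝔹ₚ λ mid → ∑𝔹ₚ λ e₁ → ∑𝔹ₚ λ e₂ →
      (vertexₚ X A w₁ n mid e₁ :* vertexₚ Y A w₂ mid s e₂) :* F e₁ e₂

    rVertexₚ : (X Y : Polynomial k) (w₁ w₂ e₁ e₂ : Bool) → Polynomial k
    rVertexₚ X Y false false false false = X
    rVertexₚ X Y false true  false true  = X
    rVertexₚ X Y false true  true  false = Y :- X
    rVertexₚ X Y true  false true  false = Y
    rVertexₚ X Y true  true  true  true  = Y
    rVertexₚ X Y _     _     _     _     = con (+ 0)

    attachRₚ : (X Y : Polynomial k) (w₁ w₂ : Bool) (F : Bool → Bool → Polynomial k) → Polynomial k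
    attachRₚ X Y w₁ w₂ F = ∑𝔹ₚ λ h₁ → ∑𝔹ₚ λ h₂ → rVertexₚ X Y w₁ w₂ h₁ h₂ :* F h₁ h₂

    table : (p q r s : Polynomial k) → Bool → Bool → Polynomial k
    table p q r s false false = p
    table p q r s false true  = q
    table p q r s true  false = r
    table p q r s true  true  = s

    eastₚ : Bool → Bool → Polynomial k
    eastₚ e₁ e₂ = indₚ e₁ :* indₚ e₂

  open Symbolic

  yangBaxter : ∀ x y a⁻¹ w₁ w₂ n s (F : Bool → Bool → Carrier) →
    attachR x y w₁ w₂ (λ h₁ h₂ → column x y a⁻¹ h₁ h₂ n s F) ≈
    column y x a⁻¹ w₁ w₂ n s (λ e₁ e₂ → attachR x y e₁ e₂ F)
  yangBaxter x y a⁻¹ w₁ w₂ n s F = byCases w₁ w₂ n s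
    where
    ybe : ∀ {k} → Bool → Bool → Bool → Bool → (X Y A f₀₀ f₀₁ f₁₀ f₁₁ : Polynomial k) →
      Polynomial k × Polynomial k
    ybe w₁ w₂ n s X Y A f₀₀ f₀₁ f₁₀ f₁₁ =
      attachRₚ X Y w₁ w₂ (λ h₁ h₂ → columnₚ X Y A h₁ h₂ n s (table f₀₀ f₀₁ f₁₀ f₁₁)) :=
      columnₚ Y X A w₁ w₂ n s (λ e₁ e₂ → attachRₚ X Y e₁ e₂ (table f₀₀ f₀₁ f₁₀ f₁₁))

    F₀₀ F₀₁ F₁₀ F₁₁ : Carrier
    F₀₀ = F false false
    F₀₁ = F false true
    F₁₀ = F true false
    F₁₁ = F true true

    byCases : ∀ w₁ w₂ n s → attachR x y w₁ w₂ (λ h₁ h₂ → column x y a⁻¹ h₁ h₂ n s F) ≈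
                            column y x a⁻¹ w₁ w₂ n s (λ e₁ e₂ → attachR x y e₁ e₂ F)
    byCases false false false false = solve 7 (ybe false false false false) refl x y a⁻¹ F₀₀ F₀₁ F₁₀ F₁₁
    byCases false false false true  = solve 7 (ybe false false false true ) refl x y a⁻¹ F₀₀ F₀₁ F₁₀ F₁₁
    byCases false false true  false = solve 7 (ybe false false true  false) refl x y a⁻¹ F₀₀ F₀₁ F₁₀ F₁₁
    byCases false false true  true  = solve 7 (ybe false false true  true ) refl x y a⁻¹ F₀₀ F₀₁ F₁₀ F₁₁
    byCases false true  false false = solve 7 (ybe false true  false false) refl x y a⁻¹ F₀₀ F₀₁ F₁₀ F₁₁
    byCases false true  false true  = solve 7 (ybe false true  false true ) refl x y a⁻¹ F₀₀ F₀₁ F₁₀ F₁₁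
    byCases false true  true  false = solve 7 (ybe false true  true  false) refl x y a⁻¹ F₀₀ F₀₁ F₁₀ F₁₁
    byCases false true  true  true  = solve 7 (ybe false true  true  true ) refl x y a⁻¹ F₀₀ F₀₁ F₁₀ F₁₁
    byCases true  false false false = solve 7 (ybe true  false false false) refl x y a⁻¹ F₀₀ F₀₁ F₁₀ F₁₁
    byCases true  false false true  = solve 7 (ybe true  false false true ) refl x y a⁻¹ F₀₀ F₀₁ F₁₀ F₁₁
    byCases true  false true  false = solve 7 (ybe true  false true  false) refl x y a⁻¹ F₀₀ F₀₁ F₁₀ F₁₁
    byCases true  false true  true  = solve 7 (ybe true  false true  true ) refl x y a⁻¹ F₀₀ F₀₁ F₁₀ F₁₁
    byCases true  true  false false = solve 7 (ybe true  true  false false) refl x y a⁻¹ F₀₀ F₀₁ F₁₀ F₁₁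
    byCases true  true  false true  = solve 7 (ybe true  true  false true ) refl x y a⁻¹ F₀₀ F₀₁ F₁₀ F₁₁
    byCases true  true  true  false = solve 7 (ybe true  true  true  false) refl x y a⁻¹ F₀₀ F₀₁ F₁₀ F₁₁
    byCases true  true  true  true  = solve 7 (ybe true  true  true  true ) refl x y a⁻¹ F₀₀ F₀₁ F₁₀ F₁₁

  railroad : ∀ x y a⁻¹ k w₁ w₂ (E : Bool → Bool → Carrier) t b →
    attachR x y w₁ w₂ (λ h₁ h₂ → doubleRow x y a⁻¹ k h₁ h₂ E t b) ≈
    doubleRow y x a⁻¹ k w₁ w₂ (λ e₁ e₂ → attachR x y e₁ e₂ E) t b
  railroad x y a⁻¹ zero    w₁ w₂ E t b = refl
  railroad x y a⁻¹ (suc k) w₁ w₂ E t b = trans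
    (yangBaxter x y (a⁻¹ 1) w₁ w₂ (head t) (head b) (λ e₁ e₂ → doubleRow x y a⁻¹′ k e₁ e₂ E (tail t) (tail b)))
    (column-cong y x (a⁻¹ 1) w₁ w₂ (head t) (head b) (λ e₁ e₂ → railroad x y a⁻¹′ k e₁ e₂ E (tail t) (tail b)))
    where
    a⁻¹′ : ℕ → Carrier
    a⁻¹′ j = a⁻¹ (suc j)

  -- On the west boundary both edges are bonded to the grid (value false);
  -- there the R-vertex admits a single configuration, of weight x.
  attachR-west : ∀ x y (F : Bool → Bool → Carrier) → attachR x y false false F ≈ x * F false false
  attachR-west x y F = solve 6
    (λ X Y f₀₀ f₀₁ f₁₀ f₁₁ → attachRₚ X Y false false (table f₀₀ f₀₁ f₁₀ f₁₁) := X :* f₀₀)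
    refl x y (F false false) (F false true) (F true false) (F true true)

  -- the east boundary: both east edges bonded to the grid (value true)
  eastBoundary : Bool → Bool → Carrier
  eastBoundary e₁ e₂ = ind e₁ * ind e₂

  attachR-east : ∀ x y e₁ e₂ → attachR x y e₁ e₂ eastBoundary ≈ y * eastBoundary e₁ e₂
  attachR-east x y false false = solve 2 (λ X Y → attachRₚ X Y false false eastₚ := Y :* eastₚ false false) refl x y
  attachR-east x y false true  = solve 2 (λ X Y → attachRₚ X Y false true  eastₚ := Y :* eastₚ false true ) refl x y
  attachR-east x y true  false = solve 2 (λ X Y → attachRₚ X Y true  false eastₚ := Y :* eastₚ true  false) refl x y
  attachR-east x y true  true  = solve 2 (λ X Y → attachRₚ X Y true  true  eastₚ := Y :* eastₚ true  true ) refl x y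

  -- The exchange relation for two full rows with the domain-wall west and
  -- east boundaries: insert an R-vertex at the west, push it through, and
  -- remove it at the east.
  doubleRow-exchange : ∀ x y a⁻¹ k t b →
    x * doubleRow x y a⁻¹ k false false eastBoundary t b ≈ y * doubleRow y x a⁻¹ k false false eastBoundary t b
  doubleRow-exchange x y a⁻¹ k t b = begin
    x * doubleRow x y a⁻¹ k false false eastBoundary t b
      ≈⟨ attachR-west x y (λ h₁ h₂ → doubleRow x y a⁻¹ k h₁ h₂ eastBoundary t b) ⟨
    attachR x y false false (λ h₁ h₂ → doubleRow x y a⁻¹ k h₁ h₂ eastBoundary t b)
      ≈⟨ railroad x y a⁻¹ k false false eastBoundary t b ⟩
    doubleRow y x a⁻¹ k false false (λ e₁ e₂ → attachR x y e₁ e₂ eastBoundary) t b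
      ≈⟨ doubleRow-cong y x a⁻¹ k false false t b (attachR-east x y) ⟩
    doubleRow y x a⁻¹ k false false (λ e₁ e₂ → y * eastBoundary e₁ e₂) t b
      ≈⟨ doubleRow-*ˡ y x a⁻¹ k false false y eastBoundary t b ⟩
    y * doubleRow y x a⁻¹ k false false eastBoundary t b ∎

  -- Weight of one configuration of the horizontal edges h of a row of k
  -- vertices (h (inject₁ j) west of column j, h (suc j) east of it),
  -- including the east boundary condition.
  rowWeight : (k : ℕ) (a⁻¹ : ℕ → Carrier) (x : Carrier) (h : Fin (suc k) → Bool) (t b : Fin k → Bool) → Carrier
  rowWeight k a⁻¹ x h t b = ind (h (fromℕ k)) *
    prodFin k (λ j → vertex x (a⁻¹ (suc (toℕ j))) (h (inject₁ j)) (t j) (b j) (h (suc j)))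

  rowWeightFrom : (k : ℕ) (a⁻¹ : ℕ → Carrier) (x : Carrier) (w : Bool) (h t b : Fin k → Bool) → Carrier
  rowWeightFrom zero    a⁻¹ x w h t b = ind w
  rowWeightFrom (suc k) a⁻¹ x w h t b = vertex x (a⁻¹ 1) w (head t) (head b) (head h) *
    rowWeightFrom k (λ j → a⁻¹ (suc j)) x (head h) (tail h) (tail t) (tail b)

  rowWeight≈rowWeightFrom : ∀ k a⁻¹ x h t b → rowWeight k a⁻¹ x h t b ≈ rowWeightFrom k a⁻¹ x (head h) (tail h) t b
  rowWeight≈rowWeightFrom zero    a⁻¹ x h t b = *-identityʳ _
  rowWeight≈rowWeightFrom (suc k) a⁻¹ x h t b = trans (*-leftComm _ _ _)
    (*-congˡ (rowWeight≈rowWeightFrom k (λ j → a⁻¹ (suc j)) x (tail h) (tail t) (tail b)))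

  ∑-rowWeightFrom : ∀ k a⁻¹ x w t b → ∑ (allFuns k bools) (λ h → rowWeightFrom k a⁻¹ x w h t b) ≈ row x a⁻¹ k w ind t b
  ∑-rowWeightFrom zero    a⁻¹ x w t b = +-identityʳ _
  ∑-rowWeightFrom (suc k) a⁻¹ x w t b = begin
    ∑ (allFuns (suc k) bools) (λ h → rowWeightFrom (suc k) a⁻¹ x w h t b)
      ≈⟨ ∑-allFuns-suc k bools _ (λ e h → V e * rowWeightFrom k a⁻¹′ x e h (tail t) (tail b)) (λ _ → refl) ⟩
    ∑ bools (λ e → ∑ (allFuns k bools) (λ h → V e * rowWeightFrom k a⁻¹′ x e h (tail t) (tail b)))
      ≈⟨ ∑-bools (λ e → ∑ (allFuns k bools) (λ h → V e * rowWeightFrom k a⁻¹′ x e h (tail t) (tail b))) ⟩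
    ∑𝔹 (λ e → ∑ (allFuns k bools) (λ h → V e * rowWeightFrom k a⁻¹′ x e h (tail t) (tail b)))
      ≈⟨ ∑𝔹-cong (λ e → trans (sym (∑-*ˡ (allFuns k bools) (V e) _))
                             (*-congˡ (∑-rowWeightFrom k a⁻¹′ x e (tail t) (tail b)))) ⟩
    row x a⁻¹ (suc k) w ind t b ∎
    where
    a⁻¹′ : ℕ → Carrier
    a⁻¹′ j = a⁻¹ (suc j)
    V : Bool → Carrier
    V e = vertex x (a⁻¹ 1) w (head t) (head b) e

module Lattice {c ℓ} (R : CommutativeRing c ℓ) (m : ℕ) (lam : Fin (suc m) → ℕ)
  (a⁻¹ : ℕ → CommutativeRing.Carrier R) where
  open CommutativeRing R hiding (zero)
  open Sums R
  open IntegerCoefficients R using (solve; _:=_; _:*_)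
  open Rows R m lam
  open Model R using (prodFin)
  module M = Model R
  open import Relation.Binary.Reasoning.Setoid setoid
  open import Algebra.Properties.CommutativeSemigroup *-commutativeSemigroup
    using () renaming (x∙yz≈y∙xz to *-leftComm)

  rows cols : ℕ
  rows = suc m
  cols = M.N m lam

  -- vertical edge values between two consecutive grid rows
  Row : Set
  Row = Fin cols → Bool

  allRows : List Row
  allRows = allFuns cols bools

  -- horizontal edge values of one grid row (west boundary first)
  HRow : Set
  HRow = Fin (suc cols) → Bool

  allHRows : List HRow
  allHRows = allFuns (suc cols) bools

  rowTransferWeight : Carrier → HRow → Row → Row → Carrier
  rowTransferWeight x h t b = ind (not (head h)) * rowWeight cols a⁻¹ x h t b

  transfer : Carrier → Row → Row → Carrier
  transfer x t b = ∑ allHRows (λ h → rowTransferWeight x h t b)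

  transfer≈row : ∀ x t b → transfer x t b ≈ row x a⁻¹ cols false ind t b
  transfer≈row x t b = begin
    transfer x t b
      ≈⟨ ∑-allFuns-suc cols bools _ (λ w h → ind (not w) * rowWeightFrom cols a⁻¹ x w h t b)
           (λ h → *-congˡ (rowWeight≈rowWeightFrom cols a⁻¹ x h t b)) ⟩
    ∑ bools (λ w → ∑ interior (λ h → ind (not w) * rowWeightFrom cols a⁻¹ x w h t b))
      ≈⟨ ∑-bools (λ w → ∑ interior (λ h → ind (not w) * rowWeightFrom cols a⁻¹ x w h t b)) ⟩
    ∑ interior (λ h → 1# * F false h) + ∑ interior (λ h → 0# * F true h)
      ≈⟨ +-cong (trans (sym (∑-*ˡ interior 1# (F false))) (*-identityˡ _))
                (trans (sym (∑-*ˡ interior 0# (F true))) (zeroˡ _)) ⟩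
    ∑ interior (F false) + 0#
      ≈⟨ +-identityʳ _ ⟩
    ∑ interior (F false)
      ≈⟨ ∑-rowWeightFrom cols a⁻¹ x false t b ⟩
    row x a⁻¹ cols false ind t b ∎
    where
    interior : List (Fin cols → Bool)
    interior = allFuns cols bools
    F : Bool → (Fin cols → Bool) → Carrier
    F w h = rowWeightFrom cols a⁻¹ x w h t b

  south : Row → Carrier
  south t = ind (M.allB m lam cols (λ j → not (t j)))

  open TransferChains R allRows transfer south public

  T²≈doubleRow : ∀ x y t b → T² x y t b ≈ doubleRow x y a⁻¹ cols false false eastBoundary t b
  T²≈doubleRow x y t b = trans
    (∑-cong allRows (λ mid → *-cong (transfer≈row x t mid) (transfer≈row y mid b)))
    (row-row x y cols a⁻¹ false false ind ind t b)

  exchange : ∀ x y t b → x * T² x y t b ≈ y * T² y x t b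
  exchange x y t b = begin
    x * T² x y t b                                          ≈⟨ *-congˡ (T²≈doubleRow x y t b) ⟩
    x * doubleRow x y a⁻¹ cols false false eastBoundary t b ≈⟨ doubleRow-exchange x y a⁻¹ cols t b ⟩
    y * doubleRow y x a⁻¹ cols false false eastBoundary t b ≈⟨ *-congˡ (T²≈doubleRow y x t b) ⟨
    y * T² y x t b                                          ∎

  -- The north boundary condition on the top row t of vertical edges.  Defs
  -- only states it as part of the λ-boundary condition, so we evaluate that
  -- condition on a configuration whose other boundaries are satisfied.
  northOK : Row → Bool
  northOK t = M.boundaryOK m lam westEastOK northOnly
    where
    westEastOK : M.HEdges m lam
    westEastOK r zero    = false
    westEastOK r (suc j) = true
    northOnly : M.VEdges m lam
    northOnly zero    = t
    northOnly (suc i) = λ _ → false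

  all-true : ∀ {a} {A : Set a} (l : List A) → all (λ _ → true) l ≡ true
  all-true []      = PE.refl
  all-true (_ ∷ l) = all-true l

  boundary-split : ∀ h v → M.boundaryOK m lam h v ≡
    M.allB m lam rows (λ r → not (h r zero)) ∧ (M.allB m lam rows (λ r → h r (fromℕ cols)) ∧
    (M.allB m lam cols (λ j → not (v (fromℕ rows) j)) ∧ northOK (v zero)))
  boundary-split h v = PE.cong (λ z → westOK ∧ (eastOK ∧ (southOK ∧ z)))
    (true∧ _ _ _ _ (all-true (allFin rows)) (all-true (allFin rows)) (all-true (allFin cols)))
    where
    westOK eastOK southOK : Bool
    westOK  = M.allB m lam rows (λ r → not (h r zero))
    eastOK  = M.allB m lam rows (λ r → h r (fromℕ cols))
    southOK = M.allB m lam cols (λ j → not (v (fromℕ rows) j))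
    true∧ : ∀ p q r z → p ≡ true → q ≡ true → r ≡ true → z ≡ p ∧ (q ∧ (r ∧ z))
    true∧ .true .true .true z PE.refl PE.refl PE.refl = PE.refl

  configWeight : (j : ℕ) → (Fin j → Carrier) → (Fin j → HRow) → (Fin (suc j) → Row) → Carrier
  configWeight j xs h v =
    prodFin j (λ r → rowTransferWeight (xs r) (h r) (v (inject₁ r)) (v (suc r))) * south (v (fromℕ j))

  module _ (h : M.HEdges m lam) (v : M.VEdges m lam) where
    westInd eastInd iceInd : Carrier
    westInd = prodFin rows (λ r → ind (not (h r zero)))
    eastInd = prodFin rows (λ r → ind (h r (fromℕ cols)))
    iceInd  = prodFin rows (λ r → prodFin cols (λ j → ind (M.validVertex m lam h v r j)))

    ind-boundaryOK : ind (M.boundaryOK m lam h v) ≈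
      westInd * (eastInd * (south (v (fromℕ rows)) * ind (northOK (v zero))))
    ind-boundaryOK = begin
      ind (M.boundaryOK m lam h v)          ≡⟨ PE.cong ind (boundary-split h v) ⟩
      ind (W ∧ (E ∧ (S ∧ N)))               ≈⟨ trans (ind-∧ W _) (*-congˡ (trans (ind-∧ E _) (*-congˡ (ind-∧ S N)))) ⟩
      ind W * (ind E * (ind S * ind N))     ≈⟨ *-cong (ind-all-tabulate rows (λ r → not (h r zero)) (λ r → r))
                                                (*-congʳ (ind-all-tabulate rows (λ r → h r (fromℕ cols)) (λ r → r))) ⟩
      westInd * (eastInd * (ind S * ind N)) ∎
      where
      W E S N : Bool
      W = M.allB m lam rows (λ r → not (h r zero))
      E = M.allB m lam rows (λ r → h r (fromℕ cols))
      S = M.allB m lam cols (λ j → not (v (fromℕ rows) j))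
      N = northOK (v zero)

    ind-ice : ind (M.allB m lam rows (λ r → M.allB m lam cols (λ j → M.validVertex m lam h v r j))) ≈ iceInd
    ind-ice = trans (ind-all-tabulate rows (λ r → M.allB m lam cols (M.validVertex m lam h v r)) (λ r → r))
                    (prodFin-cong rows (λ r → ind-all-tabulate cols (M.validVertex m lam h v r) (λ j → j)))

    rows-factor : ∀ x → prodFin rows (λ r → rowTransferWeight (x r) (h r) (v (inject₁ r)) (v (suc r))) ≈
      westInd * (eastInd * (iceInd * M.stateWeight m lam x a⁻¹ h v))
    rows-factor x = begin
      prodFin rows (λ r → wr r * (er r * prodFin cols (λ j → ice r j * wt r j)))
        ≈⟨ prodFin-cong rows (λ r → *-congˡ {wr r} (*-congˡ {er r} (prodFin-* cols (ice r) (wt r)))) ⟩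
      prodFin rows (λ r → wr r * (er r * (prodFin cols (ice r) * prodFin cols (wt r))))
        ≈⟨ prodFin-* rows wr (λ r → er r * (prodFin cols (ice r) * prodFin cols (wt r))) ⟩
      westInd * prodFin rows (λ r → er r * (prodFin cols (ice r) * prodFin cols (wt r)))
        ≈⟨ *-congˡ (trans (prodFin-* rows er (λ r → prodFin cols (ice r) * prodFin cols (wt r)))
                          (*-congˡ (prodFin-* rows (λ r → prodFin cols (ice r)) (λ r → prodFin cols (wt r))))) ⟩
      westInd * (eastInd * (iceInd * M.stateWeight m lam x a⁻¹ h v)) ∎
      where
      wr er : Fin rows → Carrier
      wr r = ind (not (h r zero))
      er r = ind (h r (fromℕ cols))
      ice wt : Fin rows → Fin cols → Carrier
      ice r j = ind (M.validVertex m lam h v r j)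
      wt r j = M.vertexWeight m lam (x r) (a⁻¹ (suc (toℕ j)))
        (M.bN m lam h v r j) (M.bS m lam h v r j) (M.bW m lam h v r j) (M.bE m lam h v r j)

    stateTerm-factor : ∀ x →
      (if M.isState m lam h v then M.stateWeight m lam x a⁻¹ h v else 0#) ≈
      ind (northOK (v zero)) * configWeight rows x h v
    stateTerm-factor x = begin
      (if M.isState m lam h v then SW else 0#)
        ≈⟨ if-as-ind (M.isState m lam h v) SW ⟩
      ind (M.isState m lam h v) * SW
        ≈⟨ *-congʳ (trans (ind-∧ (M.boundaryOK m lam h v) _) (*-cong ind-boundaryOK ind-ice)) ⟩
      ((westInd * (eastInd * (S * N))) * iceInd) * SW
        ≈⟨ solve 6 (λ w e s n i q → ((w :* (e :* (s :* n))) :* i) :* q := n :* ((w :* (e :* (i :* q))) :* s))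
                   refl westInd eastInd S N iceInd SW ⟩
      N * ((westInd * (eastInd * (iceInd * SW))) * S)
        ≈⟨ *-congˡ (*-congʳ (rows-factor x)) ⟨
      N * configWeight rows x h v ∎
      where
      SW S N : Carrier
      SW = M.stateWeight m lam x a⁻¹ h v
      S  = south (v (fromℕ rows))
      N  = ind (northOK (v zero))

  pathWeight : (j : ℕ) → (Fin j → Carrier) → Row → (Fin j → Row) → Carrier
  pathWeight zero    xs t rest = south t
  pathWeight (suc j) xs t rest = transfer (head xs) t (head rest) * pathWeight j (tail xs) (head rest) (tail rest)

  ∑-horizontal : ∀ j xs (v : Fin (suc j) → Row) →
    ∑ (allFuns j allHRows) (λ h → configWeight j xs h v) ≈ pathWeight j xs (head v) (tail v)
  ∑-horizontal zero    xs v = trans (+-identityʳ _) (*-identityˡ _)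
  ∑-horizontal (suc j) xs v = begin
    ∑ (allFuns (suc j) allHRows) (λ h → configWeight (suc j) xs h v)
      ≈⟨ ∑-allFuns-suc j allHRows _ (λ h₀ h → top h₀ * configWeight j (tail xs) h (tail v)) (λ _ → *-assoc _ _ _) ⟩
    ∑ allHRows (λ h₀ → ∑ (allFuns j allHRows) (λ h → top h₀ * configWeight j (tail xs) h (tail v)))
      ≈⟨ ∑-cong allHRows (λ h₀ → trans (sym (∑-*ˡ (allFuns j allHRows) (top h₀) _))
                                        (*-congˡ (∑-horizontal j (tail xs) (tail v)))) ⟩
    ∑ allHRows (λ h₀ → top h₀ * pathWeight j (tail xs) (v (suc zero)) (tail (tail v)))
      ≈⟨ ∑-*ʳ allHRows _ top ⟨
    pathWeight (suc j) xs (head v) (tail v) ∎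
    where
    top : HRow → Carrier
    top h₀ = rowTransferWeight (head xs) h₀ (head v) (v (suc zero))

  ∑-vertical : ∀ j xs t → ∑ (allFuns j allRows) (pathWeight j xs t) ≈ chain (tabulate xs) t
  ∑-vertical zero    xs t = +-identityʳ _
  ∑-vertical (suc j) xs t = begin
    ∑ (allFuns (suc j) allRows) (pathWeight (suc j) xs t)
      ≈⟨ ∑-allFuns-suc j allRows _ (λ b rest → transfer (head xs) t b * pathWeight j (tail xs) b rest) (λ _ → refl) ⟩
    ∑ allRows (λ b → ∑ (allFuns j allRows) (λ rest → transfer (head xs) t b * pathWeight j (tail xs) b rest))
      ≈⟨ ∑-cong allRows (λ b → trans (sym (∑-*ˡ (allFuns j allRows) (transfer (head xs) t b) _))
                                     (*-congˡ (∑-vertical j (tail xs) b))) ⟩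
    chain (tabulate xs) t ∎

  Z≈chain : ∀ x → M.Z m lam x a⁻¹ ≈ ∑ allRows (λ t → ind (northOK t) * chain (tabulate x) t)
  Z≈chain x = begin
    M.Z m lam x a⁻¹
      ≈⟨ ∑-concatMap _ Lh ⟩
    ∑ Lh (λ h → ∑ Lv (λ v → term h v))
      ≈⟨ ∑-cong Lh (λ h → ∑-cong Lv (λ v → stateTerm-factor h v x)) ⟩
    ∑ Lh (λ h → ∑ Lv (λ v → N v * configWeight rows x h v))
      ≈⟨ ∑-comm Lh Lv _ ⟩
    ∑ Lv (λ v → ∑ Lh (λ h → N v * configWeight rows x h v))
      ≈⟨ ∑-cong Lv (λ v → trans (sym (∑-*ˡ Lh (N v) _)) (*-congˡ (∑-horizontal rows x v))) ⟩
    ∑ Lv (λ v → N v * pathWeight rows x (head v) (tail v))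
      ≈⟨ ∑-allFuns-suc rows allRows _ (λ t rest → ind (northOK t) * pathWeight rows x t rest) (λ _ → refl) ⟩
    ∑ allRows (λ t → ∑ (allFuns rows allRows) (λ rest → ind (northOK t) * pathWeight rows x t rest))
      ≈⟨ ∑-cong allRows (λ t → trans (sym (∑-*ˡ (allFuns rows allRows) (ind (northOK t)) _))
                                     (*-congˡ (∑-vertical rows x t))) ⟩
    ∑ allRows (λ t → ind (northOK t) * chain (tabulate x) t) ∎
    where
    Lh : List (M.HEdges m lam)
    Lh = allFuns rows allHRows
    Lv : List (M.VEdges m lam)
    Lv = allFuns (suc rows) allRows
    term : M.HEdges m lam → M.VEdges m lam → Carrier
    term h v = if M.isState m lam h v then M.stateWeight m lam x a⁻¹ h v else 0#
    N : M.VEdges m lam → Carrier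
    N v = ind (northOK (head v))

  xNegδZ≈twisted : ∀ x x⁻¹ → M.xNegδZ m lam x x⁻¹ a⁻¹ ≈
    ∑ allRows (λ t → ind (northOK t) * twisted (tabulate (λ i → x i , x⁻¹ i)) t)
  xNegδZ≈twisted x x⁻¹ = begin
    δ * M.Z m lam x a⁻¹
      ≈⟨ *-congˡ (Z≈chain x) ⟩
    δ * ∑ allRows (λ t → ind (northOK t) * chain (tabulate x) t)
      ≈⟨ ∑-*ˡ allRows δ _ ⟩
    ∑ allRows (λ t → δ * (ind (northOK t) * chain (tabulate x) t))
      ≈⟨ ∑-cong allRows (λ t → trans (*-leftComm _ _ _) (*-congˡ (twisted-tabulate rows x x⁻¹ t))) ⟩
    ∑ allRows (λ t → ind (northOK t) * twisted (tabulate (λ i → x i , x⁻¹ i)) t) ∎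
    where
    δ : Carrier
    δ = M.xNegδ m lam x⁻¹

-- Permuting the (invertible) parameters permutes the factors of the
-- twisted chain, which leaves it unchanged.
mainTheorem5 : ∀ {c ℓ : Level} (R : CommutativeRing c ℓ) (m : ℕ)
    (lam : Fin (suc m) → ℕ) → IsPartition lam →
    (x xinv : Fin (suc m) → CommutativeRing.Carrier R) →
    (∀ i → CommutativeRing._≈_ R (CommutativeRing._*_ R (x i) (xinv i)) (CommutativeRing.1# R)) →
    (a ainv : ℕ → CommutativeRing.Carrier R) →
    (∀ j → CommutativeRing._≈_ R (CommutativeRing._*_ R (a j) (ainv j)) (CommutativeRing.1# R)) →
    (σ : Permutation′ (suc m)) →
    CommutativeRing._≈_ R
      (Model.xNegδZ R m lam (λ i → x (σ ⟨$⟩ʳ i)) (λ i → xinv (σ ⟨$⟩ʳ i)) ainv)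
      (Model.xNegδZ R m lam x xinv ainv)
mainTheorem5 R m lam _ x xinv xxinv≈1 _ ainv _ σ = begin
  Model.xNegδZ R m lam (λ i → x (σ ⟨$⟩ʳ i)) (λ i → xinv (σ ⟨$⟩ʳ i)) ainv
    ≈⟨ xNegδZ≈twisted (λ i → x (σ ⟨$⟩ʳ i)) (λ i → xinv (σ ⟨$⟩ʳ i)) ⟩
  ∑ allRows (λ t → ind (northOK t) * twisted (tabulate (λ i → x (σ ⟨$⟩ʳ i) , xinv (σ ⟨$⟩ʳ i))) t)
    ≈⟨ ∑-cong allRows (λ t → *-congˡ (twisted-↭ exchange
         (tabulate-permute (suc m) σ (λ i → x i , xinv i)) (tabulate⁺ (λ i → xxinv≈1 (σ ⟨$⟩ʳ i))) t)) ⟩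
  ∑ allRows (λ t → ind (northOK t) * twisted (tabulate (λ i → x i , xinv i)) t)
    ≈⟨ xNegδZ≈twisted x xinv ⟨
  Model.xNegδZ R m lam x xinv ainv ∎
  where
  open CommutativeRing R
  open Sums R
  open Lattice R m lam ainv
  open import Relation.Binary.Reasoning.Setoid setoid
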